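{- Let $\mathcal{M}=(X,\leq,R,V)$ and $\mathcal{M}'=(X',\leq',R',V')$ be strictly condensed $\mathsf{Int}_{\Box}$-models such that $\leq$, $\leq'$, $R$ and $R'$ are image-compact. Then for all $x\in X$ and $x'\in X'$, $x$ and $x'$ are $\mathsf{Int}_{\Box}$-bisimilar if and only if they satisfy exactly the same $\mathsf{Int}_{\Box}$-formulae.
   Context: For relations $Z,Z'$ write $x(Z\circ Z')y$ iff there is $u$ with $xZu$ and $uZ'y$; $Z[x]=\{y\mid xZy\}$. $\mathsf{Int}_\Box$ is intuitionistic propositional logic ($\top,\bot,p,\wedge,\vee,\to$ over a set $\mathrm{Prop}$) extended with a unary $\Box$. An $\mathsf{Int}_{\Box}$-model is $(X,\leq,R,V)$ with $\leq$ a preorder, $R\subseteq X\times X$ satisfying $({\leq}\circ R)\subseteq(R\circ{\leq})$, and $V$ mapping each variable to an upset of $(X,\leq)$; it is strictly condensed if $({\leq}\circ R\circ{\leq})\subseteq R$. Truth: $x\Vdash p$ iff $x\in V(p)$; $\wedge,\vee,\top,\bot$ as usual; $x\Vdash\phi\to\psi$ iff for all $y\geq x$, $y\Vdash\phi$ implies $y\Vdash\psi$; $x\Vdash\Box\phi$ iff $y\Vdash\phi$ for all $y$ with $xRy$. For upsets $a,b$: $a\Rightarrow b=\{x\mid\forall y\geq x(y\in a\Rightarrow y\in b)\}$, $\boxminus_R a=\{x\mid R[x]\subseteq a\}$. A relation $Z\in\{\leq,R\}$ of the model is image-compact if there is a collection $A$ of upsets containing $\emptyset,X$ and all $V(p)$,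 closed under finite unions, finite intersections, $\Rightarrow$ and $\boxminus_R$, such that $Z[x]$ is compact for every $x$ in the topology generated by the subbase $A\cup\{X\setminus a\mid a\in A\}$. An $\mathsf{Int}_\Box$-bisimulation is $B\subseteq X\times X'$ such that for all $(x,x')\in B$: $x\in V(p)$ iff $x'\in V'(p)$ for all $p$; if $x\leq y$ there is $y'$ with $x'\leq'y'$, $yBy'$; if $x'\leq'y'$ there is $y$ with $x\leq y$, $yBy'$; if $xRy$ there is $y'$ with $x'R'y'$, $yBy'$; if $x'R'y'$ there is $y$ with $xRy$, $yBy'$. States are bisimilar if some bisimulation contains the pair. -}

module Defs where

open import Level using (0ℓ)
open import Data.Product using (Σ; ∃; _×_; _,_)
open import Data.Sum using (_⊎_)
open import Data.Empty using (⊥)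
open import Data.Unit using (⊤)
open import Data.Bool using (Bool; true; false)
open import Data.List using (List)
open import Data.List.Relation.Unary.All using (All)
open import Data.List.Relation.Unary.Any using (Any)
open import Relation.Nullary using (¬_)

data Form (Prop : Set) : Set where
  var  : Prop → Form Prop
  ⊤'   : Form Prop
  ⊥'   : Form Prop
  _∧'_ : Form Prop → Form Prop → Form Prop
  _∨'_ : Form Prop → Form Prop → Form Prop
  _⇒'_ : Form Prop → Form Prop → Form Prop
  □'   : Form Prop → Form Prop

record Model (Prop : Set) : Set₁ where
  field
    X     : Set
    _≤_   : X → X → Set
    R     : X → X → Set
    V     : Prop → X → Set
    ≤-refl  : ∀ x → x ≤ x
    ≤-trans : ∀ {x y z} → x ≤ y → y ≤ z → x ≤ z
    ≤R⊆R≤ : ∀ {x u y} → x ≤ u → R u y → ∃ λ v → R x v × v ≤ y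
    V-up  : ∀ p {x y} → x ≤ y → V p x → V p y

module _ {Prop : Set} (M : Model Prop) where
  open Model M

  StrictlyCondensed : Set
  StrictlyCondensed = ∀ {x u v y} → x ≤ u → R u v → v ≤ y → R x y

  _⊩_ : X → Form Prop → Set
  x ⊩ var p    = V p x
  x ⊩ ⊤'       = ⊤
  x ⊩ ⊥'       = ⊥
  x ⊩ (φ ∧' ψ) = (x ⊩ φ) × (x ⊩ ψ)
  x ⊩ (φ ∨' ψ) = (x ⊩ φ) ⊎ (x ⊩ ψ)
  x ⊩ (φ ⇒' ψ) = ∀ y → x ≤ y → y ⊩ φ → y ⊩ ψ
  x ⊩ □' φ     = ∀ y → R x y → y ⊩ φ

  Subset : Set₁
  Subset = X → Set

  IsUpset : Subset → Set
  IsUpset a = ∀ {x y} → x ≤ y → a x → a y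

  _⇒ˢ_ : Subset → Subset → Subset
  (a ⇒ˢ b) x = ∀ y → x ≤ y → a y → b y

  ⊟ : Subset → Subset
  ⊟ a x = ∀ y → R x y → a y

  record GoodCollection (A : Subset → Set) : Set₁ where
    field
      upsets : ∀ {a} → A a → IsUpset a
      has-∅  : A (λ _ → ⊥)
      has-X  : A (λ _ → ⊤)
      has-V  : ∀ p → A (V p)
      ∪-cl   : ∀ {a b} → A a → A b → A (λ x → a x ⊎ b x)
      ∩-cl   : ∀ {a b} → A a → A b → A (λ x → a x × b x)
      ⇒-cl   : ∀ {a b} → A a → A b → A (a ⇒ˢ b)
      ⊟-cl   : ∀ {a} → A a → A (⊟ a)

  module Topology (A : Subset → Set) where
    -- subbasic sets: a ∈ A (true) or the complement X ∖ a of some a ∈ A (false)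
    record SubbasicCode : Set₁ where
      constructor code
      field
        set      : Subset
        inA      : A set
        positive : Bool

    ⟦_⟧ : SubbasicCode → Subset
    ⟦ code a _ true  ⟧ x = a x
    ⟦ code a _ false ⟧ x = ¬ a x

    -- the topology generated by the subbase A ∪ {X ∖ a | a ∈ A}:
    -- O is open iff every point of O lies in a finite intersection of
    -- subbasic sets that is contained in O
    IsOpen : Subset → Set₁
    IsOpen O = ∀ x → O x →
      Σ (List SubbasicCode) λ cs →
        All (λ c → ⟦ c ⟧ x) cs ×
        (∀ y → All (λ c → ⟦ c ⟧ y) cs → O y)

    IsCompact : Subset → Set₁
    IsCompact K =
      (I : Set) (U : I → Subset) → (∀ i → IsOpen (U i)) →
      (∀ x → K x → ∃ λ i → U i x) →
      Σ (List I) λ is → ∀ x → K x → Any (λ i → U i x) is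

  ImageCompact : (X → X → Set) → Set₁
  ImageCompact Z = Σ (Subset → Set) λ A →
    GoodCollection A × (∀ x → Topology.IsCompact A (Z x))

module _ {Prop : Set} (M M' : Model Prop) where
  private
    module M  = Model M
    module M' = Model M'

  IsBisimulation : (M.X → M'.X → Set) → Set
  IsBisimulation B = ∀ {x x'} → B x x' →
    (∀ p → (M.V p x → M'.V p x') × (M'.V p x' → M.V p x)) ×
    (∀ y  → x M.≤ y    → ∃ λ y' → x' M'.≤ y' × B y y') ×
    (∀ y' → x' M'.≤ y' → ∃ λ y  → x M.≤ y × B y y') ×
    (∀ y  → M.R x y    → ∃ λ y' → M'.R x' y' × B y y') ×
    (∀ y' → M'.R x' y' → ∃ λ y  → M.R x y × B y y')

  Bisimilar : M.X → M'.X → Set₁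
  Bisimilar x x' = Σ (M.X → M'.X → Set) λ B → IsBisimulation B × B x x'

  ModallyEquivalent : M.X → M'.X → Set
  ModallyEquivalent x x' = ∀ φ → (_⊩_ M x φ → _⊩_ M' x' φ) × (_⊩_ M' x' φ → _⊩_ M x φ)

{-# OPTIONS --safe #-}
module Submission where

-- Conversely, modal
-- equivalence is itself a bisimulation.  Let x ≡ x' and x' ≤ y', and suppose no y ≥ x is
-- equivalent to y'.  Each such y is separated from y' by an implication that holds at y but
-- is refuted at y' (⊤ ⇒ φ or φ ⇒ ⊥ for a formula φ on which they differ).  The set where a
-- fixed implication holds is open in the topology of the image-compactness condition, so
-- finitely many of these sets cover ≤[x]; conjoining their premises and disjoining their
-- conclusions gives one implication true on all of ≤[x], i.e. at x, hence at x', hence at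
-- y': a contradiction.  For R the same argument uses □(φ ⇒ ψ), which holds at x as soon as
-- φ ⇒ ψ holds on R[x] because the model is strictly condensed.

open import Defs
open import Level using (suc; 0ℓ; lift; lower)
open import Data.Product using (_×_; ∃; _,_; proj₁; proj₂; swap; map₂)
open import Data.Sum using (inj₁; inj₂; [_,_])
open import Data.Empty using (⊥-elim)
open import Data.Unit using (tt)
open import Data.Bool using (true; false)
open import Data.List using (List; []; _∷_)
open import Data.List.Relation.Unary.All using ([]; _∷_)
open import Data.List.Relation.Unary.Any using (Any; here; there)
open import Relation.Nullary using (¬_; Dec; yes; no)
open import Relation.Nullary.Decidable using (map′; decidable-stable)
open import Axiom.ExcludedMiddle using (ExcludedMiddle)

module _ {Prop : Set} where

  module _ (M : Model Prop) {A : Subset M → Set} (G : GoodCollection M A) where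
    open GoodCollection G

    truth-set∈collection : ∀ φ → A (λ x → _⊩_ M x φ)
    truth-set∈collection (var p)  = has-V p
    truth-set∈collection ⊤'       = has-X
    truth-set∈collection ⊥'       = has-∅
    truth-set∈collection (φ ∧' ψ) = ∩-cl (truth-set∈collection φ) (truth-set∈collection ψ)
    truth-set∈collection (φ ∨' ψ) = ∪-cl (truth-set∈collection φ) (truth-set∈collection ψ)
    truth-set∈collection (φ ⇒' ψ) = ⇒-cl (truth-set∈collection φ) (truth-set∈collection ψ)
    truth-set∈collection (□' φ)   = ⊟-cl (truth-set∈collection φ)

  □⇒-from-image : (M : Model Prop) → StrictlyCondensed M →
    ∀ {x φ ψ} → (∀ z → Model.R M x z → _⊩_ M z φ → _⊩_ M z ψ) → _⊩_ M x (□' (φ ⇒' ψ))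
  □⇒-from-image M condensed {x} image-entails z xRz w z≤w =
    image-entails w (condensed (Model.≤-refl M x) xRz z≤w)

  ModallyEquivalent-sym : (M M' : Model Prop) → ∀ {x x'} →
    ModallyEquivalent M M' x x' → ModallyEquivalent M' M x' x
  ModallyEquivalent-sym M M' x≡x' φ = swap (x≡x' φ)

  module _ (M M' : Model Prop) {B : Model.X M → Model.X M' → Set}
           (isB : IsBisimulation M M' B) where
    private
      _⊩₁_ : Model.X M → Form Prop → Set
      _⊩₁_ = _⊩_ M
      _⊩₂_ : Model.X M' → Form Prop → Set
      _⊩₂_ = _⊩_ M'

    bisimulation⇒equivalence : ∀ {x x'} → B x x' → ModallyEquivalent M M' x x'
    bisimulation⇒equivalence b (var p) = proj₁ (isB b) p
    bisimulation⇒equivalence b ⊤' = (λ _ → tt) , (λ _ → tt)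
    bisimulation⇒equivalence b ⊥' = (λ ()) , (λ ())
    bisimulation⇒equivalence b (φ ∧' ψ) =
      (λ (p , q) → proj₁ (bisimulation⇒equivalence b φ) p , proj₁ (bisimulation⇒equivalence b ψ) q) ,
      (λ (p , q) → proj₂ (bisimulation⇒equivalence b φ) p , proj₂ (bisimulation⇒equivalence b ψ) q)
    bisimulation⇒equivalence b (φ ∨' ψ) =
      (λ { (inj₁ p) → inj₁ (proj₁ (bisimulation⇒equivalence b φ) p)
         ; (inj₂ q) → inj₂ (proj₁ (bisimulation⇒equivalence b ψ) q) }) ,
      (λ { (inj₁ p) → inj₁ (proj₂ (bisimulation⇒equivalence b φ) p)
         ; (inj₂ q) → inj₂ (proj₂ (bisimulation⇒equivalence b ψ) q) })
    bisimulation⇒equivalence {x} {x'} b (φ ⇒' ψ) with isB b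
    ... | _ , forth-≤ , back-≤ , _ = forth , back
      where
      forth : x ⊩₁ (φ ⇒' ψ) → x' ⊩₂ (φ ⇒' ψ)
      forth x⊩ y' x'≤y' y'⊩φ with back-≤ y' x'≤y'
      ... | y , x≤y , b′ = proj₁ (bisimulation⇒equivalence b′ ψ)
                             (x⊩ y x≤y (proj₂ (bisimulation⇒equivalence b′ φ) y'⊩φ))
      back : x' ⊩₂ (φ ⇒' ψ) → x ⊩₁ (φ ⇒' ψ)
      back x'⊩ y x≤y y⊩φ with forth-≤ y x≤y
      ... | y' , x'≤y' , b′ = proj₂ (bisimulation⇒equivalence b′ ψ)
                                (x'⊩ y' x'≤y' (proj₁ (bisimulation⇒equivalence b′ φ) y⊩φ))
    bisimulation⇒equivalence {x} {x'} b (□' φ) with isB b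
    ... | _ , _ , _ , forth-R , back-R = forth , back
      where
      forth : x ⊩₁ (□' φ) → x' ⊩₂ (□' φ)
      forth x⊩ y' x'Ry' with back-R y' x'Ry'
      ... | y , xRy , b′ = proj₁ (bisimulation⇒equivalence b′ φ) (x⊩ y xRy)
      back : x' ⊩₂ (□' φ) → x ⊩₁ (□' φ)
      back x'⊩ y xRy with forth-R y xRy
      ... | y' , x'Ry' , b′ = proj₂ (bisimulation⇒equivalence b′ φ) (x'⊩ y' x'Ry')

module Classical (em : ExcludedMiddle (suc 0ℓ)) where

  decide : (P : Set) → Dec P
  decide P = map′ lower lift em

  by-contradiction : {P : Set} → ¬ ¬ P → P
  by-contradiction {P} = decidable-stable (decide P)

  module Separation {Prop : Set} (N M : Model Prop) (w : Model.X M) where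
    private
      _⊩ᴺ_ : Model.X N → Form Prop → Set
      _⊩ᴺ_ = _⊩_ N
      _⊩ᴹ_ : Model.X M → Form Prop → Set
      _⊩ᴹ_ = _⊩_ M

    record Separator : Set where
      field
        premise conclusion : Form Prop
        holds : w ⊩ᴹ premise
        fails : ¬ w ⊩ᴹ conclusion
    open Separator

    Region : Separator → Subset N
    Region s z = z ⊩ᴺ premise s → z ⊩ᴺ conclusion s

    join : List Separator → Separator
    join [] = record { premise = ⊤' ; conclusion = ⊥' ; holds = tt ; fails = λ () }
    join (s ∷ ss) = record
      { premise    = premise s ∧' premise (join ss)
      ; conclusion = conclusion s ∨' conclusion (join ss)
      ; holds      = holds s , holds (join ss)
      ; fails      = [ fails s , fails (join ss) ]
      }

    Any-Region⇒Region-join : ∀ {ss z} → Any (λ s → Region s z) ss → Region (join ss) z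
    Any-Region⇒Region-join (here z∈s)    (z⊩p , _)  = inj₁ (z∈s z⊩p)
    Any-Region⇒Region-join (there z∈ss)  (_ , z⊩ps) = inj₂ (Any-Region⇒Region-join z∈ss z⊩ps)

    unseparated⇒equivalent : ∀ z → ¬ (∃ λ s → Region s z) → ModallyEquivalent N M z w
    unseparated⇒equivalent z unseparated φ = z⊩φ⇒w⊩φ , w⊩φ⇒z⊩φ
      where
      z⊩φ⇒w⊩φ : z ⊩ᴺ φ → w ⊩ᴹ φ
      z⊩φ⇒w⊩φ z⊩φ = by-contradiction λ w⊮φ → unseparated
        (record { premise = ⊤' ; conclusion = φ ; holds = tt ; fails = w⊮φ } , λ _ → z⊩φ)
      w⊩φ⇒z⊩φ : w ⊩ᴹ φ → z ⊩ᴺ φ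
      w⊩φ⇒z⊩φ w⊩φ = by-contradiction λ z⊮φ → unseparated
        (record { premise = φ ; conclusion = ⊥' ; holds = w⊩φ ; fails = λ () } , z⊮φ)

    module _ {A : Subset N → Set} (G : GoodCollection N A) where
      open Topology N A

      Region-open : ∀ s → IsOpen (Region s)
      Region-open s z z∈s with decide (z ⊩ᴺ premise s)
      ... | yes z⊩p = (code _ (truth-set∈collection N G (conclusion s)) true ∷ []) , (z∈s z⊩p ∷ []) ,
                      λ { y (y⊩c ∷ []) _ → y⊩c }
      ... | no z⊮p  = (code _ (truth-set∈collection N G (premise s)) false ∷ []) , (z⊮p ∷ []) ,
                      λ { y (y⊮p ∷ []) y⊩p → ⊥-elim (y⊮p y⊩p) }

      compact-separation : ∀ {K} → IsCompact K → (∀ z → K z → ∃ λ s → Region s z) →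
        ∃ λ s → ∀ z → K z → Region s z
      compact-separation compact separated =
        let (ss , subcover) = compact Separator Region Region-open separated
        in join ss , λ z z∈K → Any-Region⇒Region-join (subcover z z∈K)

      equivalent∈compact : ∀ {K} → IsCompact K →
        (∀ φ ψ → (∀ z → K z → z ⊩ᴺ φ → z ⊩ᴺ ψ) → w ⊩ᴹ φ → w ⊩ᴹ ψ) →
        ∃ λ z → K z × ModallyEquivalent N M z w
      equivalent∈compact compact respects = by-contradiction λ none →
        let (s , K⊆s) = compact-separation compact λ z z∈K → by-contradiction λ unseparated →
                          none (z , z∈K , unseparated⇒equivalent z unseparated)
        in fails s (respects (premise s) (conclusion s) K⊆s (holds s))

  module _ {Prop : Set} (M M' : Model Prop) where
    private
      module M  = Model M
      module M' = Model M'

    back-≤ : ImageCompact M M._≤_ → ∀ {x x'} → ModallyEquivalent M M' x x' →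
      ∀ y' → x' M'.≤ y' → ∃ λ y → x M.≤ y × ModallyEquivalent M M' y y'
    back-≤ (_ , G , compact) {x} x≡x' y' x'≤y' =
      equivalent∈compact G (compact x) λ φ ψ x⊩φ⇒ψ y'⊩φ →
        proj₁ (x≡x' (φ ⇒' ψ)) x⊩φ⇒ψ y' x'≤y' y'⊩φ
      where open Separation M M' y'

    back-R : StrictlyCondensed M → ImageCompact M M.R → ∀ {x x'} → ModallyEquivalent M M' x x' →
      ∀ y' → M'.R x' y' → ∃ λ y → M.R x y × ModallyEquivalent M M' y y'
    back-R condensed (_ , G , compact) {x} x≡x' y' x'Ry' =
      equivalent∈compact G (compact x) λ φ ψ image-entails y'⊩φ →
        proj₁ (x≡x' (□' (φ ⇒' ψ))) (□⇒-from-image M condensed {φ = φ} {ψ} image-entails)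
          y' x'Ry' y' (M'.≤-refl y') y'⊩φ
      where open Separation M M' y'

  equivalence-is-bisimulation : {Prop : Set} (M M' : Model Prop) →
    StrictlyCondensed M → StrictlyCondensed M' →
    ImageCompact M (Model._≤_ M) → ImageCompact M (Model.R M) →
    ImageCompact M' (Model._≤_ M') → ImageCompact M' (Model.R M') →
    IsBisimulation M M' (ModallyEquivalent M M')
  equivalence-is-bisimulation M M' condensed condensed' compact-≤ compact-R compact-≤' compact-R' {x} {x'} x≡x' =
    (λ p → x≡x' (var p)) ,
    (λ y x≤y → swap-equivalence (back-≤ M' M compact-≤' x'≡x y x≤y)) ,
    back-≤ M M' compact-≤ x≡x' ,
    (λ y xRy → swap-equivalence (back-R M' M condensed' compact-R' x'≡x y xRy)) ,
    back-R M M' condensed compact-R x≡x'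
    where
    x'≡x : ModallyEquivalent M' M x' x
    x'≡x = ModallyEquivalent-sym M M' x≡x'
    swap-equivalence : ∀ {y} {Z : Model.X M' → Set} → (∃ λ y' → Z y' × ModallyEquivalent M' M y' y) →
           ∃ λ y' → Z y' × ModallyEquivalent M M' y y'
    swap-equivalence = map₂ (map₂ (ModallyEquivalent-sym M' M))

open Classical using (equivalence-is-bisimulation)

theorem5p10 : ExcludedMiddle (suc 0ℓ) →
    {Prop : Set} (M M' : Model Prop) →
    StrictlyCondensed M → StrictlyCondensed M' →
    ImageCompact M (Model._≤_ M) → ImageCompact M (Model.R M) →
    ImageCompact M' (Model._≤_ M') → ImageCompact M' (Model.R M') →
    (x : Model.X M) (x' : Model.X M') →
    (Bisimilar M M' x x' → ModallyEquivalent M M' x x') ×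
    (ModallyEquivalent M M' x x' → Bisimilar M M' x x')
theorem5p10 em M M' condensed condensed' compact-≤ compact-R compact-≤' compact-R' x x' =
  (λ (_ , isB , b) → bisimulation⇒equivalence M M' isB b) ,
  (λ x≡x' → ModallyEquivalent M M' ,
            equivalence-is-bisimulation em M M' condensed condensed' compact-≤ compact-R compact-≤' compact-R' ,
            x≡x')
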